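{- Let $Y$ be a connected $4$-regular graph. Then its line graph $L(Y)$ has a triangle decomposition if and only if $Y = K_5$.
   Context: Graphs are simple. The line graph $L(Y)$ has the edges of $Y$ as vertices, two being adjacent when they share an endpoint. A triangle decomposition of a graph is a partition of its edge set into edge-disjoint triangles (copies of $K_3$). -}

module Defs where

open import Data.Nat using (ℕ)
open import Data.Bool using (Bool; T; true; false)
open import Data.Fin using (Fin; _<_)
open import Data.List using (List; length; filterᵇ; allFin)
open import Data.Product using (Σ; ∃; _×_; _,_; proj₁; proj₂)
open import Data.Sum using (_⊎_; inj₁; inj₂)
open import Relation.Binary.PropositionalEquality using (_≡_; _≢_; sym; refl)
open import Relation.Nullary using (¬_)
open import Function.Bundles using (_↔_; _⇔_; Inverse)

record Graph (V : Set) : Set₁ where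
  field
    Adj       : V → V → Set
    Adj-sym   : ∀ {u v} → Adj u v → Adj v u
    Adj-irref : ∀ {v} → ¬ Adj v v
open Graph public

record FinGraph (n : ℕ) : Set where
  field
    adj       : Fin n → Fin n → Bool
    adj-sym   : ∀ u v → adj u v ≡ adj v u
    adj-irref : ∀ v → adj v v ≡ false
open FinGraph public

toGraph : ∀ {n} → FinGraph n → Graph (Fin n)
toGraph Y = record
  { Adj       = λ u v → T (adj Y u v)
  ; Adj-sym   = λ {u} {v} p → subst-T (adj-sym Y u v) p
  ; Adj-irref = λ {v} p → irr (adj-irref Y v) p
  }
  where
    subst-T : ∀ {a b : Bool} → a ≡ b → T a → T b
    subst-T refl x = x
    irr : ∀ {a : Bool} → a ≡ false → ¬ T a
    irr refl ()

degree : ∀ {n} → FinGraph n → Fin n → ℕ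
degree Y v = length (filterᵇ (adj Y v) (allFin _))

Regular : ∀ {n} → ℕ → FinGraph n → Set
Regular k Y = ∀ v → degree Y v ≡ k

-- Walks and connectivity (a connected graph is nonempty).
data Walk {V : Set} (G : Graph V) : V → V → Set where
  [] : ∀ {v} → Walk G v v
  _∷_ : ∀ {u v w} → Adj G u v → Walk G v w → Walk G u w

Connected : ∀ {V : Set} → Graph V → Set
Connected {V} G = V × (∀ u v → Walk G u v)

-- Edges of a finite graph: unordered pairs {u,v}, stored as (u , v) with u < v.
Edge : ∀ {n} → FinGraph n → Set
Edge {n} Y = Σ (Fin n × Fin n) λ p → (proj₁ p < proj₂ p) × T (adj Y (proj₁ p) (proj₂ p))

endpoints : ∀ {n} {Y : FinGraph n} → Edge Y → Fin n × Fin n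
endpoints e = proj₁ e

ShareEndpoint : ∀ {n} {Y : FinGraph n} → Edge Y → Edge Y → Set
ShareEndpoint {Y = Y} e f =
  let (a , b) = endpoints {Y = Y} e ; (c , d) = endpoints {Y = Y} f in
  (a ≡ c) ⊎ (a ≡ d) ⊎ (b ≡ c) ⊎ (b ≡ d)

LineGraph : ∀ {n} (Y : FinGraph n) → Graph (Edge Y)
LineGraph Y = record
  { Adj       = λ e f → (e ≢ f) × ShareEndpoint {Y = Y} e f
  ; Adj-sym   = λ {e} {f} (ne , sh) → (λ eq → ne (sym eq)) , swap {e} {f} sh
  ; Adj-irref = λ (ne , _) → ne refl
  }
  where
    swap : ∀ {e f} → ShareEndpoint {Y = Y} e f → ShareEndpoint {Y = Y} f e
    swap (inj₁ p) = inj₁ (sym p)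
    swap (inj₂ (inj₁ p)) = inj₂ (inj₂ (inj₁ (sym p)))
    swap (inj₂ (inj₂ (inj₁ p))) = inj₂ (inj₁ (sym p))
    swap (inj₂ (inj₂ (inj₂ p))) = inj₂ (inj₂ (inj₂ (sym p)))

IsTriangle : ∀ {V : Set} → Graph V → V × V × V → Set
IsTriangle G (a , b , c) = Adj G a b × Adj G b c × Adj G a c

EdgeOf : ∀ {V : Set} → V → V → V × V × V → Set
EdgeOf x y (a , b , c) =
  ((x ≡ a) × (y ≡ b)) ⊎ ((x ≡ b) × (y ≡ a)) ⊎
  ((x ≡ b) × (y ≡ c)) ⊎ ((x ≡ c) × (y ≡ b)) ⊎
  ((x ≡ a) × (y ≡ c)) ⊎ ((x ≡ c) × (y ≡ a))

TriangleDecomposition : ∀ {V : Set} → Graph V → Set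
TriangleDecomposition {V} G =
  Σ ℕ λ k → Σ (Fin k → V × V × V) λ tri →
    (∀ t → IsTriangle G (tri t)) ×
    (∀ x y → Adj G x y →
       Σ (Fin k) λ t → EdgeOf x y (tri t) × (∀ t′ → EdgeOf x y (tri t′) → t′ ≡ t))

Complete : (V : Set) → Graph V
Complete V = record
  { Adj       = λ u v → u ≢ v
  ; Adj-sym   = λ ne eq → ne (sym eq)
  ; Adj-irref = λ ne → ne refl
  }

K₅ : Graph (Fin 5)
K₅ = Complete (Fin 5)

_≅_ : ∀ {V W : Set} → Graph V → Graph W → Set
_≅_ {V} {W} G H = Σ (V ↔ W) λ φ → ∀ u v → Adj G u v ⇔ Adj H (Inverse.to φ u) (Inverse.to φ v)

{-# OPTIONS --safe #-}
-- A triangle of the line graph L(Y) is either a star (three edges at one vertex) or the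
-- three edges of a triangle of Y.  At a vertex v of degree 4 each of the six pairs of
-- edges at v lies in exactly one triangle of the decomposition; a star covers three of
-- them, a triangle of Y one, and two stars at v would share a pair.  So either every pair
-- at v lies in a triangle of Y, and the neighbourhood of v is a clique, or a single star
-- at v misses one edge vw, every used triangle of Y at v contains vw, and every other edge
-- vx lies in the used triangle vwx.  In the second case the edge missed at w must be wv,
-- and at a further neighbour x of v the used triangle vwx forces the missed edge at x to
-- be xv or xw; either way all other neighbours of x would have to coincide.  Hence some
-- vertex has a clique neighbourhood, which in a connected 4-regular graph is all of Y, a
-- K₅.  Conversely, when every neighbourhood is a clique, two edges sharing an endpoint
-- span exactly one triangle of Y, so the triangles of Y decompose L(Y).
module Submission where

open import Defs
open import Data.Nat as ℕ using (ℕ; zero; suc; z≤n; s≤s)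
import Data.Nat.Properties as ℕ
open import Data.Bool using (T)
open import Data.Bool.Properties using (T-irrelevant)
open import Data.Fin as Fin using (Fin; zero; suc)
import Data.Fin.Properties as Fin
open import Data.List using (List; []; _∷_; length; lookup; filter; filterᵇ; allFin; cartesianProduct)
open import Data.List.Relation.Unary.Any using (here; there; index)
open import Data.List.Relation.Unary.Any.Properties using (lookup-index)
open import Data.List.Relation.Unary.All as All using (All; []; _∷_; all?)
open import Data.List.Relation.Unary.All.Properties using (¬Any⇒All¬; ¬All⇒Any¬; all-filter)
open import Data.List.Relation.Unary.AllPairs using ([]; _∷_)
open import Data.List.Relation.Unary.Unique.Propositional using (Unique)
open import Data.List.Relation.Binary.Subset.Propositional using (_⊆_)
open import Data.List.Membership.Propositional using (_∈_; _∉_; find)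
open import Data.List.Membership.Propositional.Properties
  using (∈-lookup; ∈-filter⁺; ∈-filter⁻; ∈-allFin; ∈-cartesianProduct⁺)
import Data.List.Relation.Unary.Unique.Propositional.Properties as Unique
import Data.List.Membership.DecPropositional as DecMembership
open import Data.Product using (Σ; ∃; ∃₂; _×_; _,_; proj₁; proj₂)
open import Data.Product.Properties using (≡-dec)
open import Data.Sum using (_⊎_; inj₁; inj₂; [_,_]′)
open import Data.Empty using (⊥-elim)
open import Relation.Nullary using (¬_; yes; no; contradiction)
open import Relation.Nullary.Decidable using (T?; map′; _×-dec_)
open import Relation.Unary using (Decidable)
open import Relation.Binary.Definitions using (tri<; tri≈; tri>)
open import Function using (_∘_)
open import Function.Bundles using (_⇔_; mk⇔; mk↔ₛ′; Equivalence; Injection)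
open import Function.Properties.Inverse using (↔⇒↣)
open import Relation.Binary.Definitions using (DecidableEquality)
open import Relation.Binary.PropositionalEquality

module _ {A : Set} where

  lookup-injective : ∀ {xs : List A} → Unique xs → ∀ {i j} → lookup xs i ≡ lookup xs j → i ≡ j
  lookup-injective (_ ∷ _)     {zero}  {zero}  _  = refl
  lookup-injective (x∉ ∷ _)    {zero}  {suc j} eq = contradiction eq (All.lookup x∉ (∈-lookup j))
  lookup-injective (x∉ ∷ _)    {suc i} {zero}  eq = contradiction (sym eq) (All.lookup x∉ (∈-lookup i))
  lookup-injective (_ ∷ uxs)   {suc i} {suc j} eq = cong suc (lookup-injective uxs eq)

  unique-⊆⇒length≤ : ∀ {xs ys : List A} → Unique xs → xs ⊆ ys → length xs ℕ.≤ length ys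
  unique-⊆⇒length≤ {xs} {ys} uxs xs⊆ys = Fin.injective⇒≤ position-injective
    where
      position : Fin (length xs) → Fin (length ys)
      position i = index (xs⊆ys (∈-lookup i))

      position-injective : ∀ {i j} → position i ≡ position j → i ≡ j
      position-injective {i} {j} eq = lookup-injective uxs (begin
        lookup xs i            ≡⟨ lookup-index (xs⊆ys (∈-lookup i)) ⟩
        lookup ys (position i) ≡⟨ cong (lookup ys) eq ⟩
        lookup ys (position j) ≡⟨ lookup-index (xs⊆ys (∈-lookup j)) ⟨
        lookup xs j            ∎)
        where open ≡-Reasoning

module _ {A : Set} (_≟_ : DecidableEquality A) where
  open DecMembership _≟_ using (_∈?_)

  unique-⊆-length⇒⊇ : ∀ {xs ys : List A} → Unique xs → xs ⊆ ys → length ys ℕ.≤ length xs → ys ⊆ xs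
  unique-⊆-length⇒⊇ {xs} {ys} uxs xs⊆ys ys≤xs {y} y∈ys with y ∈? xs
  ... | yes y∈xs = y∈xs
  ... | no  y∉xs = contradiction (ℕ.≤-trans (unique-⊆⇒length≤ uyxs yxs⊆ys) ys≤xs) ℕ.1+n≰n
    where
      uyxs : Unique (y ∷ xs)
      uyxs = ¬Any⇒All¬ xs y∉xs ∷ uxs
      yxs⊆ys : y ∷ xs ⊆ ys
      yxs⊆ys (here refl)  = y∈ys
      yxs⊆ys (there x∈xs) = xs⊆ys x∈xs

  unique-longer⇒∃∉ : ∀ {xs ys : List A} → Unique xs → length ys ℕ.< length xs → ∃ λ x → x ∈ xs × x ∉ ys
  unique-longer⇒∃∉ {xs} {ys} uxs ys<xs with all? (_∈? ys) xs
  ... | yes xs⊆ys = contradiction (unique-⊆⇒length≤ uxs (All.lookup xs⊆ys)) (ℕ.<⇒≱ ys<xs)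
  ... | no  xs⊈ys = find (¬All⇒Any¬ (_∈? ys) xs xs⊈ys)

∀[A⊎B]⇒∀A⊎B : ∀ {m} {A : Fin m → Set} {B : Set} → (∀ i → A i ⊎ B) → (∀ i → A i) ⊎ B
∀[A⊎B]⇒∀A⊎B {zero}  _   = inj₁ λ ()
∀[A⊎B]⇒∀A⊎B {suc m} A⊎B with A⊎B zero | ∀[A⊎B]⇒∀A⊎B (λ i → A⊎B (suc i))
... | inj₂ b  | _        = inj₂ b
... | inj₁ _  | inj₂ b   = inj₂ b
... | inj₁ a₀ | inj₁ aₛ = inj₁ λ { zero → a₀ ; (suc i) → aₛ i }

module _ {V : Set} where

  members : V × V × V → List V
  members (a , b , c) = a ∷ b ∷ c ∷ []

  EdgeOf⇒∈ : ∀ {x y} {T : V × V × V} → EdgeOf x y T → x ∈ members T × y ∈ members T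
  EdgeOf⇒∈ (inj₁ (refl , refl))                               = here refl , there (here refl)
  EdgeOf⇒∈ (inj₂ (inj₁ (refl , refl)))                        = there (here refl) , here refl
  EdgeOf⇒∈ (inj₂ (inj₂ (inj₁ (refl , refl))))                 = there (here refl) , there (there (here refl))
  EdgeOf⇒∈ (inj₂ (inj₂ (inj₂ (inj₁ (refl , refl)))))          = there (there (here refl)) , there (here refl)
  EdgeOf⇒∈ (inj₂ (inj₂ (inj₂ (inj₂ (inj₁ (refl , refl))))))   = here refl , there (there (here refl))
  EdgeOf⇒∈ (inj₂ (inj₂ (inj₂ (inj₂ (inj₂ (refl , refl))))))   = there (there (here refl)) , here refl

  ∈⇒EdgeOf : ∀ {x y} {T : V × V × V} → x ∈ members T → y ∈ members T → x ≢ y → EdgeOf x y T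
  ∈⇒EdgeOf (here refl)                 (there (here refl))         _ = inj₁ (refl , refl)
  ∈⇒EdgeOf (there (here refl))         (here refl)                 _ = inj₂ (inj₁ (refl , refl))
  ∈⇒EdgeOf (there (here refl))         (there (there (here refl))) _ = inj₂ (inj₂ (inj₁ (refl , refl)))
  ∈⇒EdgeOf (there (there (here refl))) (there (here refl))         _ = inj₂ (inj₂ (inj₂ (inj₁ (refl , refl))))
  ∈⇒EdgeOf (here refl)                 (there (there (here refl))) _ =
    inj₂ (inj₂ (inj₂ (inj₂ (inj₁ (refl , refl)))))
  ∈⇒EdgeOf (there (there (here refl))) (here refl)                 _ =
    inj₂ (inj₂ (inj₂ (inj₂ (inj₂ (refl , refl)))))
  ∈⇒EdgeOf (here refl)                 (here refl)                 x≢x = contradiction refl x≢x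
  ∈⇒EdgeOf (there (here refl))         (there (here refl))         x≢x = contradiction refl x≢x
  ∈⇒EdgeOf (there (there (here refl))) (there (there (here refl))) x≢x = contradiction refl x≢x

module _ {V : Set} (G : Graph V) where

  Adj⇒≢ : ∀ {x y} → Adj G x y → x ≢ y
  Adj⇒≢ xy refl = Adj-irref G xy

  triangle-unique : ∀ {T} → IsTriangle G T → Unique (members T)
  triangle-unique (ab , bc , ac) = (Adj⇒≢ ab ∷ Adj⇒≢ ac ∷ []) ∷ (Adj⇒≢ bc ∷ []) ∷ [] ∷ []

  triangle-adj : ∀ {T x y} → IsTriangle G T → x ∈ members T → y ∈ members T → x ≢ y → Adj G x y
  triangle-adj (ab , bc , ac) (here refl)                 (there (here refl))         _ = ab
  triangle-adj (ab , bc , ac) (here refl)                 (there (there (here refl))) _ = ac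
  triangle-adj (ab , bc , ac) (there (here refl))         (here refl)                 _ = Adj-sym G ab
  triangle-adj (ab , bc , ac) (there (here refl))         (there (there (here refl))) _ = bc
  triangle-adj (ab , bc , ac) (there (there (here refl))) (here refl)                 _ = Adj-sym G ac
  triangle-adj (ab , bc , ac) (there (there (here refl))) (there (here refl))         _ = Adj-sym G bc
  triangle-adj _ (here refl)                 (here refl)                 x≢x = contradiction refl x≢x
  triangle-adj _ (there (here refl))         (there (here refl))         x≢x = contradiction refl x≢x
  triangle-adj _ (there (there (here refl))) (there (there (here refl))) x≢x = contradiction refl x≢x

  triangle-third : DecidableEquality V → ∀ {T x y} → IsTriangle G T → x ∈ members T → y ∈ members T → x ≢ y →
                   ∃ λ z → z ∈ members T × Adj G x z × Adj G y z × members T ⊆ x ∷ y ∷ z ∷ []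
  triangle-third _≟_ {x = x} {y} triT x∈T y∈T x≢y
    with unique-longer⇒∃∉ _≟_ {ys = x ∷ y ∷ []} (triangle-unique triT) ℕ.≤-refl
  ... | z , z∈T , z∉xy = z , z∈T , triangle-adj triT x∈T z∈T x≢z , triangle-adj triT y∈T z∈T y≢z , T⊆xyz
    where
      x≢z : x ≢ z
      x≢z refl = z∉xy (here refl)
      y≢z : y ≢ z
      y≢z refl = z∉xy (there (here refl))
      xyz⊆T : x ∷ y ∷ z ∷ [] ⊆ members _
      xyz⊆T (here refl)                 = x∈T
      xyz⊆T (there (here refl))         = y∈T
      xyz⊆T (there (there (here refl))) = z∈T
      T⊆xyz = unique-⊆-length⇒⊇ _≟_ ((x≢y ∷ x≢z ∷ []) ∷ (y≢z ∷ []) ∷ [] ∷ []) xyz⊆T ℕ.≤-refl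

module Decomposition {V : Set} {G : Graph V} (D : TriangleDecomposition G) where

  k : ℕ
  k = proj₁ D

  tri : Fin k → V × V × V
  tri = proj₁ (proj₂ D)

  tri-isTriangle : ∀ t → IsTriangle G (tri t)
  tri-isTriangle = proj₁ (proj₂ (proj₂ D))

  covering : ∀ x y → Adj G x y →
             Σ (Fin k) λ t → EdgeOf x y (tri t) × (∀ t′ → EdgeOf x y (tri t′) → t′ ≡ t)
  covering = proj₂ (proj₂ (proj₂ D))

  cover-∃ : ∀ {x y} → Adj G x y → ∃ λ t → x ∈ members (tri t) × y ∈ members (tri t)
  cover-∃ xy = let t , xy∈t , _ = covering _ _ xy in t , EdgeOf⇒∈ xy∈t

  cover-unique : ∀ {x y t t′} → x ≢ y → x ∈ members (tri t) → y ∈ members (tri t) →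
                 x ∈ members (tri t′) → y ∈ members (tri t′) → t ≡ t′
  cover-unique {x} {y} {t} {t′} x≢y x∈t y∈t x∈t′ y∈t′ =
    trans (unique t (∈⇒EdgeOf x∈t y∈t x≢y)) (sym (unique t′ (∈⇒EdgeOf x∈t′ y∈t′ x≢y)))
    where unique = proj₂ (proj₂ (covering x y (triangle-adj G (tri-isTriangle t) x∈t y∈t x≢y)))

module _ {n : ℕ} (Y : FinGraph n) where

  infix 4 _~_ _∈ₑ_

  _~_ : Fin n → Fin n → Set
  u ~ w = Adj (toGraph Y) u w

  ~-sym : ∀ {u w} → u ~ w → w ~ u
  ~-sym = Adj-sym (toGraph Y)

  ~⇒≢ : ∀ {u w} → u ~ w → u ≢ w
  ~⇒≢ = Adj⇒≢ (toGraph Y)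

  neighbours : Fin n → List (Fin n)
  neighbours v = filterᵇ (adj Y v) (allFin n)

  ∈-neighbours⁺ : ∀ {v x} → v ~ x → x ∈ neighbours v
  ∈-neighbours⁺ {v} = ∈-filter⁺ (T? ∘ adj Y v) (∈-allFin _)

  ∈-neighbours⁻ : ∀ {v x} → x ∈ neighbours v → v ~ x
  ∈-neighbours⁻ {v} = proj₂ ∘ ∈-filter⁻ (T? ∘ adj Y v) {xs = allFin n}

  neighbours-unique : ∀ v → Unique (neighbours v)
  neighbours-unique v = Unique.filter⁺ (T? ∘ adj Y v) (Unique.allFin⁺ n)

  neighbour-besides : ∀ {v} (ys : List (Fin n)) → length ys ℕ.< degree Y v → ∃ λ x → v ~ x × x ∉ ys
  neighbour-besides {v} _ ys<deg with unique-longer⇒∃∉ Fin._≟_ (neighbours-unique v) ys<deg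
  ... | x , x∈N , x∉ys = x , ∈-neighbours⁻ x∈N , x∉ys

  CliqueNeighbourhood : Fin n → Set
  CliqueNeighbourhood v = ∀ {x y} → v ~ x → v ~ y → x ≢ y → x ~ y

  _∈ₑ_ : Fin n → Edge Y → Set
  x ∈ₑ ((a , b) , _) = x ≡ a ⊎ x ≡ b

  edge-ext : ∀ {e f : Edge Y} → proj₁ e ≡ proj₁ f → e ≡ f
  edge-ext {_ , a<b , ab} {_ , a<b′ , ab′} refl =
    cong₂ (λ p q → _ , p , q) (Fin.<-irrelevant a<b a<b′) (T-irrelevant ab ab′)

  _≟ₑ_ : DecidableEquality (Edge Y)
  e ≟ₑ f = map′ edge-ext (cong proj₁) (proj₁ e ≟ₚ proj₁ f)
    where _≟ₚ_ = ≡-dec Fin._≟_ Fin._≟_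

  endpoints-of : ∀ {a b} (e : Edge Y) → a ≢ b → a ∈ₑ e → b ∈ₑ e → proj₁ e ≡ (a , b) ⊎ proj₁ e ≡ (b , a)
  endpoints-of _ a≢b (inj₁ refl) (inj₁ refl) = contradiction refl a≢b
  endpoints-of _ a≢b (inj₁ refl) (inj₂ refl) = inj₁ refl
  endpoints-of _ a≢b (inj₂ refl) (inj₁ refl) = inj₂ refl
  endpoints-of _ a≢b (inj₂ refl) (inj₂ refl) = contradiction refl a≢b

  edge-≡ : ∀ {a b} {e f : Edge Y} → a ≢ b → a ∈ₑ e → b ∈ₑ e → a ∈ₑ f → b ∈ₑ f → e ≡ f
  edge-≡ {e = e} {f} a≢b a∈e b∈e a∈f b∈f with endpoints-of e a≢b a∈e b∈e | endpoints-of f a≢b a∈f b∈f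
  ... | inj₁ e≡ab | inj₁ f≡ab = edge-ext (trans e≡ab (sym f≡ab))
  ... | inj₂ e≡ba | inj₂ f≡ba = edge-ext (trans e≡ba (sym f≡ba))
  edge-≡ {e = _ , a<b , _} {_ , b<a , _} _ _ _ _ _ | inj₁ refl | inj₂ refl = contradiction a<b (Fin.<-asym b<a)
  edge-≡ {e = _ , b<a , _} {_ , a<b , _} _ _ _ _ _ | inj₂ refl | inj₁ refl = contradiction a<b (Fin.<-asym b<a)

  endpoint-cases : ∀ {a b c} {e : Edge Y} → a ≢ b → a ∈ₑ e → b ∈ₑ e → c ∈ₑ e → c ≡ a ⊎ c ≡ b
  endpoint-cases {e = e} a≢b a∈e b∈e c∈e with endpoints-of e a≢b a∈e b∈e | c∈e
  ... | inj₁ refl | inj₁ c≡a = inj₁ c≡a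
  ... | inj₁ refl | inj₂ c≡b = inj₂ c≡b
  ... | inj₂ refl | inj₁ c≡b = inj₂ c≡b
  ... | inj₂ refl | inj₂ c≡a = inj₁ c≡a

  ∈ₑ⇒~ : ∀ {a b} {e : Edge Y} → a ≢ b → a ∈ₑ e → b ∈ₑ e → a ~ b
  ∈ₑ⇒~ {e = e@(_ , _ , ab)} a≢b a∈e b∈e with endpoints-of e a≢b a∈e b∈e
  ... | inj₁ refl = ab
  ... | inj₂ refl = ~-sym ab

  edge : ∀ {a b} → a ~ b → Σ (Edge Y) λ e → a ∈ₑ e × b ∈ₑ e
  edge {a} {b} ab with Fin.<-cmp a b
  ... | tri< a<b _ _ = ((a , b) , a<b , ab) , inj₁ refl , inj₂ refl
  ... | tri≈ _ a≡b _ = contradiction a≡b (~⇒≢ ab)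
  ... | tri> _ _ b<a = ((b , a) , b<a , ~-sym ab) , inj₂ refl , inj₁ refl

  far-end : ∀ {a} (e : Edge Y) → a ∈ₑ e → Σ (Fin n) λ b → b ∈ₑ e × b ≢ a
  far-end (_ , _ , ab) (inj₁ refl) = _ , inj₂ refl , ~⇒≢ (~-sym ab)
  far-end (_ , _ , ab) (inj₂ refl) = _ , inj₁ refl , ~⇒≢ ab

  far-end-unique : ∀ {v x} {e : Edge Y} (v∈e : v ∈ₑ e) → x ∈ₑ e → x ≢ v → x ≡ proj₁ (far-end e v∈e)
  far-end-unique {e = e} v∈e x∈e x≢v with far-end e v∈e
  ... | b , b∈e , b≢v with endpoint-cases {e = e} (b≢v ∘ sym) v∈e b∈e x∈e
  ...   | inj₁ x≡v = contradiction x≡v x≢v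
  ...   | inj₂ x≡b = x≡b

  distinct-edges : ∀ {v x y} {e f : Edge Y} → v ≢ y → x ≢ v → x ≢ y → x ∈ₑ e → v ∈ₑ f → y ∈ₑ f → e ≢ f
  distinct-edges {f = f} v≢y x≢v x≢y x∈e v∈f y∈f refl = [ x≢v , x≢y ]′ (endpoint-cases {e = f} v≢y v∈f y∈f x∈e)

  far-end-injective : ∀ {v} {e f : Edge Y} (v∈e : v ∈ₑ e) (v∈f : v ∈ₑ f) →
                      proj₁ (far-end e v∈e) ≡ proj₁ (far-end f v∈f) → e ≡ f
  far-end-injective {e = e} {f} v∈e v∈f eq with far-end e v∈e | far-end f v∈f | eq
  ... | b , b∈e , b≢v | _ , b′∈f , _ | refl = edge-≡ {e = e} {f} (b≢v ∘ sym) v∈e b∈e v∈f b′∈f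

  LineAdj⇒common : ∀ {e f} → Adj (LineGraph Y) e f → ∃ λ z → z ∈ₑ e × z ∈ₑ f
  LineAdj⇒common (_ , inj₁ a≡c)                 = _ , inj₁ refl , inj₁ a≡c
  LineAdj⇒common (_ , inj₂ (inj₁ a≡d))          = _ , inj₁ refl , inj₂ a≡d
  LineAdj⇒common (_ , inj₂ (inj₂ (inj₁ b≡c)))   = _ , inj₂ refl , inj₁ b≡c
  LineAdj⇒common (_ , inj₂ (inj₂ (inj₂ b≡d)))   = _ , inj₂ refl , inj₂ b≡d

  common⇒LineAdj : ∀ {z e f} → e ≢ f → z ∈ₑ e → z ∈ₑ f → Adj (LineGraph Y) e f
  common⇒LineAdj e≢f (inj₁ refl) (inj₁ refl) = e≢f , inj₁ refl
  common⇒LineAdj e≢f (inj₁ refl) (inj₂ refl) = e≢f , inj₂ (inj₁ refl)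
  common⇒LineAdj e≢f (inj₂ refl) (inj₁ refl) = e≢f , inj₂ (inj₂ (inj₁ refl))
  common⇒LineAdj e≢f (inj₂ refl) (inj₂ refl) = e≢f , inj₂ (inj₂ (inj₂ refl))

  -- Clique neighbourhoods and complete graphs

  cliqueNeighbourhood⇒≅Complete : ∀ {d v} → Connected (toGraph Y) → Regular d Y → CliqueNeighbourhood v →
                                   toGraph Y ≅ Complete (Fin (suc d))
  cliqueNeighbourhood⇒≅Complete {d} {v} (_ , walk) regular clique =
    subst (λ m → toGraph Y ≅ Complete (Fin (suc m))) (regular v)
          (mk↔ₛ′ position (lookup ball) position-lookup lookup-position , adjacency)
    where
      ball : List (Fin n)
      ball = v ∷ neighbours v

      ball-unique : Unique ball
      ball-unique = All.tabulate (~⇒≢ ∘ ∈-neighbours⁻) ∷ neighbours-unique v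

      ball-clique : ∀ {x y} → x ∈ ball → y ∈ ball → x ≢ y → x ~ y
      ball-clique (here refl) (here refl) x≢y = contradiction refl x≢y
      ball-clique (here refl) (there y∈N) _   = ∈-neighbours⁻ y∈N
      ball-clique (there x∈N) (here refl) _   = ~-sym (∈-neighbours⁻ x∈N)
      ball-clique (there x∈N) (there y∈N) x≢y = clique (∈-neighbours⁻ x∈N) (∈-neighbours⁻ y∈N) x≢y

      -- x already has d neighbours inside the ball, so by degree d it has none outside
      ball-closed : ∀ {x y} → x ∈ ball → x ~ y → y ∈ ball
      ball-closed {x} x∈ball xy =
        unique-⊆-length⇒⊇ Fin._≟_ ball-unique ball⊆ ball-size (there (∈-neighbours⁺ xy))
        where
          ball⊆ : ball ⊆ x ∷ neighbours x
          ball⊆ {u} u∈ball with u Fin.≟ x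
          ... | yes refl = here refl
          ... | no  u≢x  = there (∈-neighbours⁺ (ball-clique x∈ball u∈ball (u≢x ∘ sym)))

          ball-size : length (x ∷ neighbours x) ℕ.≤ length ball
          ball-size = s≤s (ℕ.≤-reflexive (trans (regular x) (sym (regular v))))

      ball-all : ∀ u → u ∈ ball
      ball-all u = reach (walk v u) (here refl)
        where
          reach : ∀ {x y} → Walk (toGraph Y) x y → x ∈ ball → y ∈ ball
          reach []         x∈ball = x∈ball
          reach (xz ∷ zy) x∈ball = reach zy (ball-closed x∈ball xz)

      position : Fin n → Fin (length ball)
      position u = index (ball-all u)

      lookup-position : ∀ u → lookup ball (position u) ≡ u
      lookup-position u = sym (lookup-index (ball-all u))

      position-lookup : ∀ i → position (lookup ball i) ≡ i
      position-lookup i = lookup-injective ball-unique (lookup-position (lookup ball i))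

      adjacency : ∀ u w → u ~ w ⇔ position u ≢ position w
      adjacency u w = mk⇔
        (λ uw pu≡pw → ~⇒≢ uw (trans (sym (lookup-position u)) (trans (cong (lookup ball) pu≡pw) (lookup-position w))))
        (λ pu≢pw → ball-clique (ball-all u) (ball-all w) (pu≢pw ∘ cong position))

  ≅Complete⇒cliqueNeighbourhood : ∀ {W : Set} → toGraph Y ≅ Complete W → ∀ v → CliqueNeighbourhood v
  ≅Complete⇒cliqueNeighbourhood (φ , adjacency) _ {x} {y} _ _ x≢y =
    Equivalence.from (adjacency x y) (x≢y ∘ Injection.injective (↔⇒↣ φ))

  -- Locally complete graphs: the triangles of Y decompose L(Y)

  Sorted : Fin n × Fin n × Fin n → Set
  Sorted (a , b , c) = a Fin.< b × b Fin.< c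

  insert₃ : ∀ {u w z} → u Fin.< w → z ≢ u → z ≢ w →
            Σ (Fin n × Fin n × Fin n) λ T → Sorted T × All (_∈ members T) (u ∷ w ∷ z ∷ [])
  insert₃ {u} {w} {z} u<w z≢u z≢w with Fin.<-cmp z u | Fin.<-cmp z w
  ... | tri< z<u _ _ | _            =
    (z , u , w) , (z<u , u<w) , there (here refl) ∷ there (there (here refl)) ∷ here refl ∷ []
  ... | tri≈ _ z≡u _ | _            = contradiction z≡u z≢u
  ... | tri> _ _ u<z | tri< z<w _ _ =
    (u , z , w) , (u<z , z<w) , here refl ∷ there (there (here refl)) ∷ there (here refl) ∷ []
  ... | tri> _ _ _   | tri≈ _ z≡w _ = contradiction z≡w z≢w
  ... | tri> _ _ _   | tri> _ _ w<z =
    (u , w , z) , (u<w , w<z) , here refl ∷ there (here refl) ∷ there (there (here refl)) ∷ []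

  sort₃ : ∀ {x y z} → x ≢ y → x ≢ z → y ≢ z →
          Σ (Fin n × Fin n × Fin n) λ T → Sorted T × All (_∈ members T) (x ∷ y ∷ z ∷ [])
  sort₃ {x} {y} {z} x≢y x≢z y≢z with Fin.<-cmp x y
  ... | tri< x<y _ _ = insert₃ x<y (x≢z ∘ sym) (y≢z ∘ sym)
  ... | tri≈ _ x≡y _ = contradiction x≡y x≢y
  ... | tri> _ _ y<x with insert₃ y<x (y≢z ∘ sym) (x≢z ∘ sym)
  ...   | T , sorted , y∈T ∷ x∈T ∷ z∈T ∷ [] = T , sorted , x∈T ∷ y∈T ∷ z∈T ∷ []

  sorted-min : ∀ {a b c x} → Sorted (a , b , c) → x ∈ members (a , b , c) → a Fin.≤ x
  sorted-min _           (here refl)                 = Fin.≤-refl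
  sorted-min (a<b , _)   (there (here refl))         = ℕ.<⇒≤ a<b
  sorted-min (a<b , b<c) (there (there (here refl))) = ℕ.<⇒≤ (Fin.<-trans a<b b<c)

  sorted-max : ∀ {a b c x} → Sorted (a , b , c) → x ∈ members (a , b , c) → x Fin.≤ c
  sorted-max (a<b , b<c) (here refl)                 = ℕ.<⇒≤ (Fin.<-trans a<b b<c)
  sorted-max (_ , b<c)   (there (here refl))         = ℕ.<⇒≤ b<c
  sorted-max _           (there (there (here refl))) = Fin.≤-refl

  sorted-≡ : ∀ {T T′} → Sorted T → Sorted T′ → members T ⊆ members T′ → members T′ ⊆ members T → T ≡ T′
  sorted-≡ {a , b , c} {a′ , b′ , c′} s@(a<b , b<c) s′ T⊆T′ T′⊆T =
    cong₂ _,_ a≡a′ (cong₂ _,_ (middle (T⊆T′ (there (here refl)))) c≡c′)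
    where
      a≡a′ : a ≡ a′
      a≡a′ = Fin.≤-antisym (sorted-min s (T′⊆T (here refl))) (sorted-min s′ (T⊆T′ (here refl)))

      c≡c′ : c ≡ c′
      c≡c′ = Fin.≤-antisym (sorted-max s′ (T⊆T′ (there (there (here refl)))))
                           (sorted-max s (T′⊆T (there (there (here refl)))))

      middle : b ∈ members (a′ , b′ , c′) → b ≡ b′
      middle (here b≡a′)                 = contradiction (trans a≡a′ (sym b≡a′)) (Fin.<⇒≢ a<b)
      middle (there (here b≡b′))         = b≡b′
      middle (there (there (here b≡c′))) = contradiction (trans b≡c′ (sym c≡c′)) (Fin.<⇒≢ b<c)

  sorted-determined : ∀ {S T T′} → Unique (members S) → Sorted T → Sorted T′ →
                      members S ⊆ members T → members S ⊆ members T′ → T ≡ T′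
  sorted-determined uS sT sT′ S⊆T S⊆T′ = sorted-≡ sT sT′ (S⊆T′ ∘ T⊆S) (S⊆T ∘ T′⊆S)
    where
      T⊆S  = unique-⊆-length⇒⊇ Fin._≟_ uS S⊆T ℕ.≤-refl
      T′⊆S = unique-⊆-length⇒⊇ Fin._≟_ uS S⊆T′ ℕ.≤-refl

  SortedTriangle : Fin n × Fin n × Fin n → Set
  SortedTriangle T = Sorted T × IsTriangle (toGraph Y) T

  sortedTriangle? : Decidable SortedTriangle
  sortedTriangle? (a , b , c) =
    (a Fin.<? b ×-dec b Fin.<? c) ×-dec (T? (adj Y a b) ×-dec T? (adj Y b c) ×-dec T? (adj Y a c))

  sortedTriangle-within : ∀ {S T} → IsTriangle (toGraph Y) S → Sorted T → members S ⊆ members T → SortedTriangle T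
  sortedTriangle-within {S} {a , b , c} triS sT@(a<b , b<c) S⊆T =
    sT , adjacent (here refl) (there (here refl)) (Fin.<⇒≢ a<b)
       , adjacent (there (here refl)) (there (there (here refl))) (Fin.<⇒≢ b<c)
       , adjacent (here refl) (there (there (here refl))) (Fin.<⇒≢ (Fin.<-trans a<b b<c))
    where
      T⊆S = unique-⊆-length⇒⊇ Fin._≟_ (triangle-unique (toGraph Y) triS) S⊆T ℕ.≤-refl
      adjacent : ∀ {x y} → x ∈ members (a , b , c) → y ∈ members (a , b , c) → x ≢ y → x ~ y
      adjacent x∈T y∈T = triangle-adj (toGraph Y) triS (T⊆S x∈T) (T⊆S y∈T)

  triples : List (Fin n × Fin n × Fin n)
  triples = cartesianProduct (allFin n) (cartesianProduct (allFin n) (allFin n))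

  -- Listing every triangle of Y once, as an increasing triple, makes the covering index unique.
  sortedTriangles : List (Fin n × Fin n × Fin n)
  sortedTriangles = filter sortedTriangle? triples

  sortedTriangles-unique : Unique sortedTriangles
  sortedTriangles-unique = Unique.filter⁺ sortedTriangle?
    (Unique.cartesianProduct⁺ (Unique.allFin⁺ n) (Unique.cartesianProduct⁺ (Unique.allFin⁺ n) (Unique.allFin⁺ n)))

  ∈-sortedTriangles⁺ : ∀ {T} → SortedTriangle T → T ∈ sortedTriangles
  ∈-sortedTriangles⁺ = ∈-filter⁺ sortedTriangle?
    (∈-cartesianProduct⁺ (∈-allFin _) (∈-cartesianProduct⁺ (∈-allFin _) (∈-allFin _)))

  ∈-sortedTriangles⁻ : ∀ {T} → T ∈ sortedTriangles → SortedTriangle T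
  ∈-sortedTriangles⁻ = All.lookup (all-filter sortedTriangle? triples)

  lineTriangle : ∀ T → SortedTriangle T → Edge Y × Edge Y × Edge Y
  lineTriangle (a , b , c) ((a<b , b<c) , ab , bc , ac) =
    ((a , b) , a<b , ab) , ((b , c) , b<c , bc) , ((a , c) , Fin.<-trans a<b b<c , ac)

  lineTriangle-isTriangle : ∀ {T} (sT : SortedTriangle T) → IsTriangle (LineGraph Y) (lineTriangle T sT)
  lineTriangle-isTriangle {a , b , c} ((a<b , b<c) , _) =
    common⇒LineAdj (Fin.<⇒≢ a<b ∘ cong (proj₁ ∘ proj₁)) (inj₂ refl) (inj₁ refl) ,
    common⇒LineAdj (Fin.<⇒≢ a<b ∘ sym ∘ cong (proj₁ ∘ proj₁)) (inj₂ refl) (inj₂ refl) ,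
    common⇒LineAdj (Fin.<⇒≢ b<c ∘ cong (proj₂ ∘ proj₁)) (inj₁ refl) (inj₁ refl)

  lineTriangle-endpoints : ∀ {T x e} (sT : SortedTriangle T) → e ∈ members (lineTriangle T sT) → x ∈ₑ e → x ∈ members T
  lineTriangle-endpoints _ (here refl)                 (inj₁ refl) = here refl
  lineTriangle-endpoints _ (here refl)                 (inj₂ refl) = there (here refl)
  lineTriangle-endpoints _ (there (here refl))         (inj₁ refl) = there (here refl)
  lineTriangle-endpoints _ (there (here refl))         (inj₂ refl) = there (there (here refl))
  lineTriangle-endpoints _ (there (there (here refl))) (inj₁ refl) = here refl
  lineTriangle-endpoints _ (there (there (here refl))) (inj₂ refl) = there (there (here refl))

  lineTriangle-∋ : ∀ {T} (sT : SortedTriangle T) (e : Edge Y) → (∀ {x} → x ∈ₑ e → x ∈ members T) →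
                   e ∈ members (lineTriangle T sT)
  lineTriangle-∋ {a , b , c} ((a<b , b<c) , _) ((p , q) , p<q , _) endpoints∈T
    with endpoints∈T (inj₁ refl) | endpoints∈T (inj₂ refl)
  ... | here refl                 | there (here refl)         = here (edge-ext refl)
  ... | there (here refl)         | there (there (here refl)) = there (here (edge-ext refl))
  ... | here refl                 | there (there (here refl)) = there (there (here (edge-ext refl)))
  ... | here refl                 | here refl                 = contradiction p<q (Fin.<-irrefl refl)
  ... | there (here refl)         | there (here refl)         = contradiction p<q (Fin.<-irrefl refl)
  ... | there (there (here refl)) | there (there (here refl)) = contradiction p<q (Fin.<-irrefl refl)
  ... | there (here refl)         | here refl                 = contradiction p<q (Fin.<-asym a<b)
  ... | there (there (here refl)) | there (here refl)         = contradiction p<q (Fin.<-asym b<c)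
  ... | there (there (here refl)) | here refl                 = contradiction p<q (Fin.<-asym (Fin.<-trans a<b b<c))

  sortTriangle : ∀ {S} → IsTriangle (toGraph Y) S →
                 Σ (Fin n × Fin n × Fin n) λ T → SortedTriangle T × members S ⊆ members T
  sortTriangle {x , y , z} triS@(xy , yz , xz) with sort₃ (~⇒≢ xy) (~⇒≢ xz) (~⇒≢ yz)
  ... | T , sT , S⊆T = T , sortedTriangle-within triS sT (All.lookup S⊆T) , All.lookup S⊆T

  module _ (locallyComplete : ∀ v → CliqueNeighbourhood v) where

    spannedTriangle : ∀ {e f} → Adj (LineGraph Y) e f →
                      Σ (Fin n × Fin n × Fin n) λ S → IsTriangle (toGraph Y) S ×
                        (∀ {x} → x ∈ members S → x ∈ₑ e ⊎ x ∈ₑ f) ×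
                        (∀ {x} → x ∈ₑ e → x ∈ members S) × (∀ {x} → x ∈ₑ f → x ∈ members S)
    spannedTriangle {e} {f} (e≢f , share) with LineAdj⇒common (e≢f , share)
    ... | z , z∈e , z∈f with far-end e z∈e | far-end f z∈f
    ... | p , p∈e , p≢z | q , q∈f , q≢z = (z , p , q) , (z~p , p~q , z~q) , S⊆ef , e⊆S , f⊆S
      where
        z~p : z ~ p
        z~p = ∈ₑ⇒~ {e = e} (p≢z ∘ sym) z∈e p∈e
        z~q : z ~ q
        z~q = ∈ₑ⇒~ {e = f} (q≢z ∘ sym) z∈f q∈f
        p~q : p ~ q
        p~q = locallyComplete z z~p z~q λ { refl → e≢f (edge-≡ (p≢z ∘ sym) z∈e p∈e z∈f q∈f) }

        S⊆ef : ∀ {x} → x ∈ members (z , p , q) → x ∈ₑ e ⊎ x ∈ₑ f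
        S⊆ef (here refl)                 = inj₁ z∈e
        S⊆ef (there (here refl))         = inj₁ p∈e
        S⊆ef (there (there (here refl))) = inj₂ q∈f

        e⊆S : ∀ {x} → x ∈ₑ e → x ∈ members (z , p , q)
        e⊆S x∈e with endpoint-cases {e = e} (p≢z ∘ sym) z∈e p∈e x∈e
        ... | inj₁ refl = here refl
        ... | inj₂ refl = there (here refl)

        f⊆S : ∀ {x} → x ∈ₑ f → x ∈ members (z , p , q)
        f⊆S x∈f with endpoint-cases {e = f} (q≢z ∘ sym) z∈f q∈f x∈f
        ... | inj₁ refl = here refl
        ... | inj₂ refl = there (there (here refl))

    lineGraph-triangleDecomposition : TriangleDecomposition (LineGraph Y)
    lineGraph-triangleDecomposition = length sortedTriangles , tri , lineTriangle-isTriangle ∘ sorted , cover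
      where
        sorted : ∀ t → SortedTriangle (lookup sortedTriangles t)
        sorted t = ∈-sortedTriangles⁻ (∈-lookup t)

        tri : Fin (length sortedTriangles) → Edge Y × Edge Y × Edge Y
        tri t = lineTriangle (lookup sortedTriangles t) (sorted t)

        cover : ∀ e f → Adj (LineGraph Y) e f →
                Σ (Fin (length sortedTriangles)) λ t → EdgeOf e f (tri t) × (∀ t′ → EdgeOf e f (tri t′) → t′ ≡ t)
        cover e f e~f with spannedTriangle e~f
        ... | S , triS , S⊆ef , e⊆S , f⊆S with sortTriangle triS
        ... | T , sT , S⊆T = t , ∈⇒EdgeOf (∈t e e⊆S) (∈t f f⊆S) (proj₁ e~f) , unique
          where
            T∈ : T ∈ sortedTriangles
            T∈ = ∈-sortedTriangles⁺ sT
            t = index T∈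
            t↦T : lookup sortedTriangles t ≡ T
            t↦T = sym (lookup-index T∈)

            ∈t : ∀ g → (∀ {x} → x ∈ₑ g → x ∈ members S) → g ∈ members (tri t)
            ∈t g g⊆S = lineTriangle-∋ (sorted t) g (subst (λ T → _ ∈ members T) (sym t↦T) ∘ S⊆T ∘ g⊆S)

            unique : ∀ t′ → EdgeOf e f (tri t′) → t′ ≡ t
            unique t′ ef∈t′ = lookup-injective sortedTriangles-unique
              (trans (sorted-determined (triangle-unique (toGraph Y) triS) (proj₁ (sorted t′)) (proj₁ sT) S⊆t′ S⊆T)
                     (sym t↦T))
              where
                S⊆t′ : members S ⊆ members (lookup sortedTriangles t′)
                S⊆t′ x∈S with S⊆ef x∈S
                ... | inj₁ x∈e = lineTriangle-endpoints (sorted t′) (proj₁ (EdgeOf⇒∈ ef∈t′)) x∈e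
                ... | inj₂ x∈f = lineTriangle-endpoints (sorted t′) (proj₂ (EdgeOf⇒∈ ef∈t′)) x∈f

  -- Stars and triangles of Y in a triangle decomposition of L(Y)

  module _ (D : TriangleDecomposition (LineGraph Y)) where
    open Decomposition {G = LineGraph Y} D

    HasEdge : Edge Y × Edge Y × Edge Y → Fin n → Fin n → Set
    HasEdge T a b = ∃ λ e → e ∈ members T × a ∈ₑ e × b ∈ₑ e

    HasEdge-sym : ∀ {T a b} → HasEdge T a b → HasEdge T b a
    HasEdge-sym (e , e∈T , a∈e , b∈e) = e , e∈T , b∈e , a∈e

    HasEdge⇒~ : ∀ {T a b} → a ≢ b → HasEdge T a b → a ~ b
    HasEdge⇒~ a≢b (e , _ , a∈e , b∈e) = ∈ₑ⇒~ {e = e} a≢b a∈e b∈e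

    UsesTriangle : Fin n → Fin n → Fin n → Set
    UsesTriangle a b c = ∃ λ t → HasEdge (tri t) a b × HasEdge (tri t) b c × HasEdge (tri t) a c

    UsesTriangle⇒~ : ∀ {a b c} → b ≢ c → UsesTriangle a b c → b ~ c
    UsesTriangle⇒~ b≢c (_ , _ , bc , _) = HasEdge⇒~ b≢c bc

    UsesTriangle-swap : ∀ {a b c} → UsesTriangle a b c → UsesTriangle b a c
    UsesTriangle-swap (t , ab , bc , ac) = t , HasEdge-sym ab , ac , bc

    UsesTriangle-rotate : ∀ {a b c} → UsesTriangle a b c → UsesTriangle b c a
    UsesTriangle-rotate (t , ab , bc , ac) = t , bc , HasEdge-sym ac , HasEdge-sym ab

    StarAt : Fin n → Fin k → Set
    StarAt v t = All (v ∈ₑ_) (members (tri t))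

    cover-at : ∀ {v x y} → v ~ x → v ~ y → x ≢ y → ∃ λ t → HasEdge (tri t) v x × HasEdge (tri t) v y
    cover-at vx vy x≢y with edge vx | edge vy
    ... | ex , v∈ex , x∈ex | ey , v∈ey , y∈ey
      with cover-∃ (common⇒LineAdj (distinct-edges {e = ex} {ey} (~⇒≢ vy) (~⇒≢ vx ∘ sym) x≢y x∈ex v∈ey y∈ey) v∈ex v∈ey)
    ... | t , ex∈t , ey∈t = t , (ex , ex∈t , v∈ex , x∈ex) , (ey , ey∈t , v∈ey , y∈ey)

    cover-unique-at : ∀ {v x y t t′} → v ≢ x → v ≢ y → x ≢ y →
                      HasEdge (tri t) v x → HasEdge (tri t) v y → HasEdge (tri t′) v x → HasEdge (tri t′) v y → t ≡ t′
    cover-unique-at {t′ = t′} v≢x v≢y x≢y (ex , ex∈t , v∈ex , x∈ex) (ey , ey∈t , v∈ey , y∈ey)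
                                         (ex′ , ex′∈t′ , v∈ex′ , x∈ex′) (ey′ , ey′∈t′ , v∈ey′ , y∈ey′) =
      cover-unique (distinct-edges {e = ex} {ey} v≢y (v≢x ∘ sym) x≢y x∈ex v∈ey y∈ey) ex∈t ey∈t
        (subst (_∈ members (tri t′)) (edge-≡ {e = ex′} {ex} v≢x v∈ex′ x∈ex′ v∈ex x∈ex) ex′∈t′)
        (subst (_∈ members (tri t′)) (edge-≡ {e = ey′} {ey} v≢y v∈ey′ y∈ey′ v∈ey y∈ey) ey′∈t′)

    star-of : ∀ {v t e f g} → members (tri t) ⊆ e ∷ f ∷ g ∷ [] → v ∈ₑ e → v ∈ₑ f → v ∈ₑ g → StarAt v t
    star-of t⊆efg v∈e v∈f v∈g = All.tabulate (All.lookup (v∈e ∷ v∈f ∷ v∈g ∷ []) ∘ t⊆efg)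

    -- The third edge of the covering triangle meets vx and vy: through v it makes a star, otherwise it is xy.
    classify : ∀ {v x y t} → v ≢ x → v ≢ y → x ≢ y → HasEdge (tri t) v x → HasEdge (tri t) v y →
               HasEdge (tri t) x y ⊎ StarAt v t
    classify {t = t} v≢x v≢y x≢y (ex , ex∈t , v∈ex , x∈ex) (ey , ey∈t , v∈ey , y∈ey)
      with triangle-third (LineGraph Y) _≟ₑ_ (tri-isTriangle t) ex∈t ey∈t
             (distinct-edges {e = ex} {ey} v≢y (v≢x ∘ sym) x≢y x∈ex v∈ey y∈ey)
    ... | ez , ez∈t , ex~ez , ey~ez , t⊆ with LineAdj⇒common ex~ez | LineAdj⇒common ey~ez
    ... | a , a∈ex , a∈ez | b , b∈ey , b∈ez
      with endpoint-cases {e = ex} v≢x v∈ex x∈ex a∈ex | endpoint-cases {e = ey} v≢y v∈ey y∈ey b∈ey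
    ... | inj₁ refl | _         = inj₂ (star-of t⊆ v∈ex v∈ey a∈ez)
    ... | inj₂ _    | inj₁ refl = inj₂ (star-of t⊆ v∈ex v∈ey b∈ez)
    ... | inj₂ refl | inj₂ refl = inj₁ (ez , ez∈t , a∈ez , b∈ez)

    farEnds : ∀ {v} (T : Edge Y × Edge Y × Edge Y) → All (v ∈ₑ_) (members T) → List (Fin n)
    farEnds (A , B , C) star = proj₁ (far-end A (All.lookup star (here refl)))
                             ∷ proj₁ (far-end B (All.lookup star (there (here refl))))
                             ∷ proj₁ (far-end C (All.lookup star (there (there (here refl))))) ∷ []

    farEnds-unique : ∀ {v T} → IsTriangle (LineGraph Y) T → (star : All (v ∈ₑ_) (members T)) → Unique (farEnds T star)
    farEnds-unique {T = A , B , C} (AB , BC , AC) (v∈A ∷ v∈B ∷ v∈C ∷ []) =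
      (distinct AB v∈A v∈B ∷ distinct AC v∈A v∈C ∷ []) ∷ (distinct BC v∈B v∈C ∷ []) ∷ [] ∷ []
      where
        distinct : ∀ {v e f} → Adj (LineGraph Y) e f → (v∈e : v ∈ₑ e) (v∈f : v ∈ₑ f) →
                   proj₁ (far-end e v∈e) ≢ proj₁ (far-end f v∈f)
        distinct (e≢f , _) v∈e v∈f = e≢f ∘ far-end-injective v∈e v∈f

    far-end-edge : ∀ {v e T} (v∈e : v ∈ₑ e) → e ∈ members T →
                   HasEdge T v (proj₁ (far-end e v∈e)) × proj₁ (far-end e v∈e) ≢ v
    far-end-edge {e = e} v∈e e∈T = let b , b∈e , b≢v = far-end e v∈e in (e , e∈T , v∈e , b∈e) , b≢v

    farEnds-sound : ∀ {v T x} (star : All (v ∈ₑ_) (members T)) → x ∈ farEnds T star → HasEdge T v x × x ≢ v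
    farEnds-sound {T = A , _ , _} (v∈A ∷ _   ∷ _   ∷ []) (here refl)                 =
      far-end-edge {e = A} v∈A (here refl)
    farEnds-sound {T = _ , B , _} (_   ∷ v∈B ∷ _   ∷ []) (there (here refl))         =
      far-end-edge {e = B} v∈B (there (here refl))
    farEnds-sound {T = _ , _ , C} (_   ∷ _   ∷ v∈C ∷ []) (there (there (here refl))) =
      far-end-edge {e = C} v∈C (there (there (here refl)))

    farEnds-complete : ∀ {v T x} (star : All (v ∈ₑ_) (members T)) → HasEdge T v x → x ≢ v → x ∈ farEnds T star
    farEnds-complete {T = A , _ , _} (v∈A ∷ _   ∷ _   ∷ []) (_ , here refl                 , _ , x∈e) x≢v =
      here (far-end-unique {e = A} v∈A x∈e x≢v)
    farEnds-complete {T = _ , B , _} (_   ∷ v∈B ∷ _   ∷ []) (_ , there (here refl)         , _ , x∈e) x≢v =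
      there (here (far-end-unique {e = B} v∈B x∈e x≢v))
    farEnds-complete {T = _ , _ , C} (_   ∷ _   ∷ v∈C ∷ []) (_ , there (there (here refl)) , _ , x∈e) x≢v =
      there (there (here (far-end-unique {e = C} v∈C x∈e x≢v)))

    star-edges-through : ∀ {v t p q} → StarAt v t → p ≢ q → HasEdge (tri t) p q → v ≡ p ⊎ v ≡ q
    star-edges-through star p≢q (e , e∈t , p∈e , q∈e) = endpoint-cases {e = e} p≢q p∈e q∈e (All.lookup star e∈t)

    triangle-or-star : ∀ v x y → (v ~ x → v ~ y → x ≢ y → UsesTriangle v x y) ⊎ ∃ (StarAt v)
    triangle-or-star v x y with T? (adj Y v x) | T? (adj Y v y) | x Fin.≟ y
    ... | no ¬vx | _      | _        = inj₁ λ vx → contradiction vx ¬vx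
    ... | yes _  | no ¬vy | _        = inj₁ λ _ vy → contradiction vy ¬vy
    ... | yes _  | yes _  | yes refl = inj₁ λ _ _ x≢x → contradiction refl x≢x
    ... | yes vx | yes vy | no x≢y with cover-at vx vy x≢y
    ...   | t , vx∈t , vy∈t with classify (~⇒≢ vx) (~⇒≢ vy) x≢y vx∈t vy∈t
    ...     | inj₁ xy∈t = inj₁ λ _ _ _ → t , vx∈t , xy∈t , vy∈t
    ...     | inj₂ star = inj₂ (t , star)

    -- The situation at a vertex v carrying a star: vw is the one edge at v outside the star.
    record NonStarEdge (v w : Fin n) : Set where
      field
        adjacent          : v ~ w
        triangle-with     : ∀ {x} → v ~ x → x ≢ w → UsesTriangle v w x
        triangles-through : ∀ {p q} → p ≢ v → q ≢ v → p ≢ q → UsesTriangle v p q → p ≡ w ⊎ q ≡ w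

    module _ (regular : Regular 4 Y) where

      fewer-than-degree : ∀ {v m} → m ℕ.< 4 → m ℕ.< degree Y v
      fewer-than-degree {v} = subst (_ ℕ.<_) (sym (regular v))

      two-neighbours-besides : ∀ v w → ∃₂ λ x y → v ~ x × v ~ y × x ≢ y × x ≢ w × y ≢ w
      two-neighbours-besides v w with neighbour-besides {v} (w ∷ []) (fewer-than-degree (s≤s (s≤s z≤n)))
      ... | x , vx , x∉w with neighbour-besides {v} (w ∷ x ∷ []) (fewer-than-degree (s≤s (s≤s (s≤s z≤n))))
      ... | y , vy , y∉wx = x , y , vx , vy , (λ { refl → y∉wx (there (here refl)) }) ,
                            (x∉w ∘ here) , (y∉wx ∘ here)

      module StarAnalysis {v t} (star : StarAt v t) where

        ends : List (Fin n)
        ends = farEnds (tri t) star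

        ends-edge : ∀ {x} → x ∈ ends → HasEdge (tri t) v x
        ends-edge = proj₁ ∘ farEnds-sound star

        ends-adjacent : ∀ {x} → x ∈ ends → v ~ x
        ends-adjacent x∈ends = let vx , x≢v = farEnds-sound star x∈ends in HasEdge⇒~ (x≢v ∘ sym) vx

        missing : ∃ λ w → v ~ w × w ∉ ends
        missing = neighbour-besides ends (fewer-than-degree ℕ.≤-refl)

        w : Fin n
        w = proj₁ missing

        v~w : v ~ w
        v~w = proj₁ (proj₂ missing)

        w∉ends : w ∉ ends
        w∉ends = proj₂ (proj₂ missing)

        neighbours⊆ : neighbours v ⊆ w ∷ ends
        neighbours⊆ = unique-⊆-length⇒⊇ Fin._≟_ (¬Any⇒All¬ ends w∉ends ∷ farEnds-unique (tri-isTriangle t) star)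
                                         w∷ends⊆ (ℕ.≤-reflexive (regular v))
          where
            w∷ends⊆ : w ∷ ends ⊆ neighbours v
            w∷ends⊆ (here refl)    = ∈-neighbours⁺ v~w
            w∷ends⊆ (there x∈ends) = ∈-neighbours⁺ (ends-adjacent x∈ends)

        other-neighbour∈ends : ∀ {x} → v ~ x → x ≢ w → x ∈ ends
        other-neighbour∈ends vx x≢w with neighbours⊆ (∈-neighbours⁺ vx)
        ... | here x≡w     = contradiction x≡w x≢w
        ... | there x∈ends = x∈ends

        triangle-vwx : ∀ {x} → v ~ x → x ≢ w → UsesTriangle v w x
        triangle-vwx {x} vx x≢w with cover-at v~w vx (x≢w ∘ sym)
        ... | t′ , vw∈t′ , vx∈t′ with classify (~⇒≢ v~w) (~⇒≢ vx) (x≢w ∘ sym) vw∈t′ vx∈t′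
        ...   | inj₁ wx∈t′ = t′ , vw∈t′ , wx∈t′ , vx∈t′
        ...   | inj₂ star′
          -- a second star at v shares vx and a third edge vr with the first one, so it is the same
          with unique-longer⇒∃∉ Fin._≟_ {ys = w ∷ x ∷ []} (farEnds-unique (tri-isTriangle t′) star′) ℕ.≤-refl
        ...     | r , r∈ends′ , r∉wx =
          contradiction (farEnds-complete star (subst (λ s → HasEdge (tri s) v w) (sym t≡t′) vw∈t′) (~⇒≢ v~w ∘ sym))
                        w∉ends
          where
            vr∈t′ : HasEdge (tri t′) v r
            vr∈t′ = proj₁ (farEnds-sound star′ r∈ends′)
            r≢v : r ≢ v
            r≢v = proj₂ (farEnds-sound star′ r∈ends′)
            r∈ends : r ∈ ends
            r∈ends = other-neighbour∈ends (HasEdge⇒~ (r≢v ∘ sym) vr∈t′) (r∉wx ∘ here)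
            t≡t′ : t ≡ t′
            t≡t′ = cover-unique-at (~⇒≢ vx) (r≢v ∘ sym) (λ x≡r → r∉wx (there (here (sym x≡r))))
                     (ends-edge (other-neighbour∈ends vx x≢w)) (ends-edge r∈ends) vx∈t′ vr∈t′

        triangles-through-w : ∀ {p q} → p ≢ v → q ≢ v → p ≢ q → UsesTriangle v p q → p ≡ w ⊎ q ≡ w
        triangles-through-w {p} {q} p≢v q≢v p≢q (t″ , vp∈t″ , pq∈t″ , vq∈t″) with p Fin.≟ w | q Fin.≟ w
        ... | yes p≡w | _       = inj₁ p≡w
        ... | no _    | yes q≡w = inj₂ q≡w
        ... | no p≢w  | no q≢w  = contradiction (star-edges-through star p≢q pq∈t) [ p≢v ∘ sym , q≢v ∘ sym ]′
          where
            t″≡t : t″ ≡ t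
            t″≡t = cover-unique-at (p≢v ∘ sym) (q≢v ∘ sym) p≢q vp∈t″ vq∈t″
                     (ends-edge (other-neighbour∈ends (HasEdge⇒~ (p≢v ∘ sym) vp∈t″) p≢w))
                     (ends-edge (other-neighbour∈ends (HasEdge⇒~ (q≢v ∘ sym) vq∈t″) q≢w))
            pq∈t : HasEdge (tri t) p q
            pq∈t = subst (λ s → HasEdge (tri s) p q) t″≡t pq∈t″

        nonStarEdge : NonStarEdge v w
        nonStarEdge = record
          { adjacent = v~w ; triangle-with = triangle-vwx ; triangles-through = triangles-through-w }

      open NonStarEdge

      cliqueNeighbourhood⊎nonStarEdge : ∀ v → CliqueNeighbourhood v ⊎ ∃ (NonStarEdge v)
      cliqueNeighbourhood⊎nonStarEdge v with ∀[A⊎B]⇒∀A⊎B (λ x → ∀[A⊎B]⇒∀A⊎B (triangle-or-star v x))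
      ... | inj₁ triangles  = inj₁ λ vx vy x≢y → UsesTriangle⇒~ x≢y (triangles _ _ vx vy x≢y)
      ... | inj₂ (_ , star) = inj₂ (StarAnalysis.w star , StarAnalysis.nonStarEdge star)

      nonStarEdge-next : ∀ {v w w′ x} → NonStarEdge v w → NonStarEdge w w′ → v ~ x → x ≢ w → v ≡ w′ ⊎ x ≡ w′
      nonStarEdge-next vw ww′ vx x≢w =
        triangles-through ww′ (~⇒≢ (adjacent vw)) x≢w (~⇒≢ vx) (UsesTriangle-swap (triangle-with vw vx x≢w))

      nonStarEdge-converse : ∀ {v w w′} → NonStarEdge v w → NonStarEdge w w′ → w′ ≡ v
      nonStarEdge-converse {v} {w} vw ww′ with two-neighbours-besides v w
      ... | x , y , vx , vy , x≢y , x≢w , y≢w with nonStarEdge-next vw ww′ vx x≢w | nonStarEdge-next vw ww′ vy y≢w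
      ...   | inj₁ v≡w′ | _         = sym v≡w′
      ...   | inj₂ _    | inj₁ v≡w′ = sym v≡w′
      ...   | inj₂ x≡w′ | inj₂ y≡w′ = contradiction (trans x≡w′ (sym y≡w′)) x≢y

      no-nonStarEdge-back : ∀ {v w x} → NonStarEdge v w → v ~ x → x ≢ w → ¬ NonStarEdge x v
      no-nonStarEdge-back {v} {w} {x} vw vx x≢w xv with two-neighbours-besides x v
      ... | q₁ , q₂ , xq₁ , xq₂ , q₁≢q₂ , q₁≢v , q₂≢v = q₁≢q₂ (trans (forced xq₁ q₁≢v) (sym (forced xq₂ q₂≢v)))
        where
          forced : ∀ {q} → x ~ q → q ≢ v → q ≡ w
          forced xq q≢v with triangles-through vw (~⇒≢ vx ∘ sym) q≢v (~⇒≢ xq)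
                               (UsesTriangle-swap (triangle-with xv xq q≢v))
          ... | inj₁ x≡w = contradiction x≡w x≢w
          ... | inj₂ q≡w = q≡w

      some-cliqueNeighbourhood : Fin n → ∃ CliqueNeighbourhood
      some-cliqueNeighbourhood v with cliqueNeighbourhood⊎nonStarEdge v
      ... | inj₁ clique = v , clique
      ... | inj₂ (w , vw) with cliqueNeighbourhood⊎nonStarEdge w
      ...   | inj₁ clique = w , clique
      ...   | inj₂ (w′ , ww′) with nonStarEdge-converse vw ww′ | two-neighbours-besides v w
      ...     | refl | x , _ , vx , _ , _ , x≢w , _ with cliqueNeighbourhood⊎nonStarEdge x
      ...       | inj₁ clique = x , clique
      ...       | inj₂ (s , xs) with triangle-with vw vx x≢w
      ...         | vwx with triangles-through xs (~⇒≢ vx) (x≢w ∘ sym) (~⇒≢ (adjacent vw))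
                                               (UsesTriangle-rotate (UsesTriangle-rotate vwx))
      ...           | inj₁ refl = ⊥-elim (no-nonStarEdge-back vw vx x≢w xs)
      ...           | inj₂ refl = ⊥-elim (no-nonStarEdge-back ww′ (UsesTriangle⇒~ (x≢w ∘ sym) vwx) (~⇒≢ vx ∘ sym) xs)

mainTheorem2 : ∀ (n : ℕ) (Y : FinGraph n) →
    Connected (toGraph Y) → Regular 4 Y →
    TriangleDecomposition (LineGraph Y) ⇔ (toGraph Y ≅ K₅)
mainTheorem2 n Y connected regular = mk⇔ forward backward
  where
    forward : TriangleDecomposition (LineGraph Y) → toGraph Y ≅ K₅
    forward D = cliqueNeighbourhood⇒≅Complete Y connected regular
                  (proj₂ (some-cliqueNeighbourhood Y D regular (proj₁ connected)))

    backward : toGraph Y ≅ K₅ → TriangleDecomposition (LineGraph Y)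
    backward Y≅K₅ = lineGraph-triangleDecomposition Y (≅Complete⇒cliqueNeighbourhood Y Y≅K₅)
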